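{- Let $r\geq 2$ and $t \geq 3$ be integers. If $n = a(r+t-3) + b$ with nonnegative integers $a,b$ and $b \leq r+t-4$, then \[a\binom{r+t-3}{r} + \binom{b}{r} \leq {\rm ex}_{r}(n, {\rm B}_{\rm ind} K_{1,t-1}) \leq \frac{n}{r}\binom{r + t - 3}{r-1} .\] In particular, if $n$ is divisible by $r+t-3$, the lower bound equals $\frac{n}{r}\binom{r+t-4}{r-1}$.
   Context: $K_{1,t-1}$ is the star with one center and $t-1$ leaves. An $r$-uniform hypergraph $\mathcal H$ is a family of $r$-element subsets (edges) of a finite vertex set $V(\mathcal H)$. For a graph $F$ with vertex set $\{v_1,\dots,v_p\}$ and edge set $\{e_1,\dots,e_q\}$, $\mathcal H$ contains an induced Berge $F$ if there exist distinct vertices $W=\{w_1,\dots,w_p\}\subseteq V(\mathcal H)$ and distinct edges $f_1,\dots,f_q$ of $\mathcal H$ such that whenever $e_i=v_\alpha v_\beta$ we have $f_i\cap W=\{w_\alpha,w_\beta\}$. ${\rm ex}_r(n,{\rm B}_{\rm ind}F)$ is the maximum number of edges of an $r$-uniform hypergraph on vertex set $[n]$ with no induced Berge $F$. Binomial coefficients $\binom{b}{r}$ with $b<r$ equal $0$. -}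

module Defs where

open import Data.Nat using (ℕ; suc; _+_; _*_; _∸_; _≤_)
open import Data.Fin using (Fin; zero; suc)
open import Data.Fin.Subset using (Subset; _∈_; ∣_∣)
open import Data.List using (List; length; lookup)
open import Data.List.Relation.Unary.All using (All)
open import Data.List.Relation.Unary.Unique.Propositional using (Unique)
open import Data.Product using (Σ; _×_; _,_; proj₁; proj₂)
open import Data.Sum using (_⊎_)
open import Function using (_⇔_)
open import Function.Definitions using (Injective)
open import Relation.Binary.PropositionalEquality using (_≡_)

record Hypergraph (r n : ℕ) : Set where
  field
    edges   : List (Subset n)
    unique  : Unique edges
    uniform : All (λ e → ∣ e ∣ ≡ r) edges

open Hypergraph public

numEdges : ∀ {r n} → Hypergraph r n → ℕ
numEdges H = length (edges H)

record Graph : Set where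
  field
    p    : ℕ
    q    : ℕ
    ends : Fin q → Fin p × Fin p

open Graph public

Star : ℕ → Graph
Star m = record { p = suc m ; q = m ; ends = λ i → (zero , suc i) }

InducedBerge : ∀ {r n} → Graph → Hypergraph r n → Set
InducedBerge {r} {n} F H =
  Σ (Fin (p F) → Fin n) λ w →
  Σ (Fin (q F) → Fin (length (edges H))) λ f →
    Injective _≡_ _≡_ w × Injective _≡_ _≡_ f ×
    (∀ (i : Fin (q F)) (x : Fin (p F)) →
       (w x ∈ lookup (edges H) (f i)) ⇔
       (x ≡ proj₁ (ends F i) ⊎ x ≡ proj₂ (ends F i)))

-- Fix a vertex v and an edge e ∋ v. Shrink the complement of e greedily to
-- a minimal set T_e meeting every other edge through v. By minimality each point of T_e
-- has a private edge through v, and these edges form an induced Berge star centred at v,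
-- so |T_e| ≤ t - 2. The pairs (e - v, T_e), e ∋ v, form a Bollobás set-pair system, so
-- deg v ≤ C(r + t - 3, r - 1), and double counting gives r |E| ≤ n C(r + t - 3, r - 1).
-- Bollobás' inequality is proved in its weighted (LYM) form Σ n! / C(|A| + |B|, |B|) ≤ n!
-- by induction on n, deleting one point at a time.
--
-- Lower bound. In a disjoint union of complete r-graphs on at most r + t - 3 vertices an
-- induced Berge K_{1,t-1} would put r + t - 2 vertices into the component of its centre.

module Submission where

open import Defs
open import Data.Bool using (Bool; true; false; not; _∧_; if_then_else_)
open import Data.Bool.Properties using (∧-zeroʳ; ∧-identityʳ; ¬-not; not-injective) renaming (_≟_ to _≟ᵇ_)
open import Data.Fin using (Fin; zero; suc; punchIn; punchOut; _↑ˡ_; _↑ʳ_; splitAt; _≟_)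
open import Data.Fin.Properties using (splitAt-↑ˡ; splitAt-↑ʳ; splitAt⁻¹-↑ˡ; splitAt⁻¹-↑ʳ; punchInᵢ≢i; punchIn-punchOut; 0≢1+n; any?; all?; ¬∀⟶∃¬) renaming (suc-injective to Fin-suc-injective)
open import Data.Nat using (ℕ; zero; suc; pred; _+_; _*_; _∸_; _≤_; _<_; _≤′_; ≤′-refl; ≤′-step; z≤n; z<s; s≤s; s≤s⁻¹; _!; _/_; _⊓_; NonZero; >-nonZero; ≢-nonZero⁻¹)
open import Data.Nat.Combinatorics using (_C_; nCk≡n!/k![n-k]!; k![n∸k]!∣n!; k>n⇒nCk≡0; nCk≡nC[n∸k]; nCk+nC[k+1]≡[n+1]C[k+1])
open import Data.Nat.DivMod using (m/n*n≡m)
open import Data.Nat.Divisibility using (_∣_; ∣-trans; m∣m*n; n∣m*n; ∣m+n∣m⇒∣n; >⇒∤)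
open import Data.Nat.Tactic.RingSolver using (solve-∀)
open import Data.Nat.Properties hiding (_≟_; 0≢1+n)
open import Data.Nat.Properties using () renaming (_≟_ to _≟ℕ_)
open import Data.Product using (Σ; ∃; _×_; _,_; proj₁; proj₂)
open import Data.Sum using (_⊎_; inj₁; inj₂; [_,_]′)
open import Data.Fin.Subset using (Subset; ⊥) renaming (_∈_ to _∈ₛ_; ∣_∣ to ∣_∣ₛ)
open import Data.Fin.Subset.Properties using (∣⊥∣≡0)
open import Data.List using (List; []; _∷_; allFin; length; map) renaming (lookup to lookupₗ; _++_ to _++ₗ_)
open import Data.List.Properties using (length-map; length-++)
open import Data.List.Membership.Propositional using (_∈_)
open import Data.List.Membership.Propositional.Properties using (∈-lookup; ∈-allFin; ∈-map⁻; ∈-++⁻)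
import Data.List.Relation.Unary.All.Properties as AllP
import Data.List.Relation.Unary.Unique.Propositional.Properties as Unique
open import Data.List.Relation.Unary.All as All using (All)
open import Data.List.Relation.Unary.AllPairs using ([]; _∷_)
open import Data.List.Relation.Unary.Any using (here; there)
open import Data.List.Relation.Unary.Unique.Propositional using (Unique)
open import Data.Vec using (Vec; []; _∷_; lookup; _++_)
open import Data.Vec.Properties using (∷-injectiveʳ; []=⇒lookup; lookup⇒[]=; tabulate∘lookup; tabulate-cong; lookup-++ˡ; lookup-++ʳ; lookup-replicate; ++-injectiveˡ; ++-injectiveʳ)
open import Function.Bundles using (Equivalence; mk⇔)
open import Function using (_∘_; const)
open import Function.Definitions using (Injective)
open import Relation.Nullary using (¬_; does; yes; no; contradiction)
open import Relation.Nullary.Decidable using (Dec; dec-true; dec-false; _×-dec_; _→-dec_)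
open import Relation.Binary.PropositionalEquality

open import Algebra.Properties.Semiring.Sum +-*-semiring
  using (sum; sum-cong-≗; ∑-distrib-+; sum-remove; ∑-comm)

sum-mono-≤ : ∀ {n} {f g : Fin n → ℕ} → (∀ x → f x ≤ g x) → sum f ≤ sum g
sum-mono-≤ {zero}  f≤g = z≤n
sum-mono-≤ {suc n} f≤g = +-mono-≤ (f≤g zero) (sum-mono-≤ (f≤g ∘ suc))

sum-const : ∀ n c → sum {n} (const c) ≡ n * c
sum-const zero    c = refl
sum-const (suc n) c = cong (c +_) (sum-const n c)

sum-zero : ∀ n → sum {n} (const 0) ≡ 0
sum-zero n = trans (sum-const n 0) (*-zeroʳ n)

sum-↑ : ∀ m {n} (f : Fin (m + n) → ℕ) → sum f ≡ sum (f ∘ (_↑ˡ n)) + sum (f ∘ (m ↑ʳ_))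
sum-↑ zero    f = refl
sum-↑ (suc m) f = trans (cong (f zero +_) (sum-↑ m (f ∘ suc))) (sym (+-assoc (f zero) _ _))

sum-concentrated : ∀ {n} (f : Fin n → ℕ) (k : Fin n) → (∀ j → j ≢ k → f j ≡ 0) → sum f ≡ f k
sum-concentrated {suc n} f k zero-off = begin
  sum f                     ≡⟨ sum-remove {i = k} f ⟩
  f k + sum (f ∘ punchIn k) ≡⟨ cong (f k +_) (sum-cong-≗ (zero-off _ ∘ punchInᵢ≢i k)) ⟩
  f k + sum {n} (const 0)   ≡⟨ cong (f k +_) (sum-zero n) ⟩
  f k + 0                   ≡⟨ +-identityʳ (f k) ⟩
  f k                       ∎
  where open ≡-Reasoning

count : ∀ {n} → (Fin n → Bool) → ℕ
count P = sum (λ x → if P x then 1 else 0)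

sum-if-const : ∀ {n} (P : Fin n → Bool) c → sum (λ x → if P x then c else 0) ≡ count P * c
sum-if-const {zero}  P c = refl
sum-if-const {suc n} P c with P zero
... | true  = cong (c +_) (sum-if-const (P ∘ suc) c)
... | false = sum-if-const (P ∘ suc) c

_⊆ᵇ_ : ∀ {n} → (Fin n → Bool) → (Fin n → Bool) → Set
P ⊆ᵇ Q = ∀ x → P x ≡ true → Q x ≡ true

Disjointᵇ : ∀ {n} → (Fin n → Bool) → (Fin n → Bool) → Set
Disjointᵇ P Q = ∀ x → P x ≡ true → Q x ≡ false

Meetsᵇ : ∀ {n} → (Fin n → Bool) → (Fin n → Bool) → Set
Meetsᵇ P Q = ∃ λ x → P x ≡ true × Q x ≡ true

Nonemptyᵇ : ∀ {n} → (Fin n → Bool) → Set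
Nonemptyᵇ P = ∃ λ x → P x ≡ true

count-remove : ∀ {n} (P : Fin (suc n) → Bool) x → count P ≡ (if P x then 1 else 0) + count (P ∘ punchIn x)
count-remove P x = sum-remove {i = x} (λ y → if P y then 1 else 0)

count-const : ∀ n b → count {n} (const b) ≡ (if b then n else 0)
count-const n true  = trans (sum-const n 1) (*-identityʳ n)
count-const n false = trans (sum-const n 0) (*-zeroʳ n)

count-mono : ∀ {n} {P Q : Fin n → Bool} → P ⊆ᵇ Q → count P ≤ count Q
count-mono {P = P} {Q} P⊆Q = sum-mono-≤ λ x → pointwise (P x) (Q x) (P⊆Q x)
  where
  pointwise : ∀ p q → (p ≡ true → q ≡ true) → (if p then 1 else 0) ≤ (if q then 1 else 0)
  pointwise false q     _   = z≤n
  pointwise true  false p⇒q with () ← p⇒q refl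
  pointwise true  true  _   = ≤-refl

count≤n : ∀ {n} (P : Fin n → Bool) → count P ≤ n
count≤n {n} P = subst (count P ≤_) (count-const n true) (count-mono {P = P} {Q = const true} λ _ _ → refl)

count-punchIn-false : ∀ {n} (P : Fin (suc n) → Bool) {x} → P x ≡ false → count P ≡ count (P ∘ punchIn x)
count-punchIn-false P {x} Px = trans (count-remove P x) (cong (λ b → (if b then 1 else 0) + count (P ∘ punchIn x)) Px)

count-punchIn-true : ∀ {n} (P : Fin (suc n) → Bool) {x} → P x ≡ true → count P ≡ suc (count (P ∘ punchIn x))
count-punchIn-true P {x} Px = trans (count-remove P x) (cong (λ b → (if b then 1 else 0) + count (P ∘ punchIn x)) Px)

count-⊂ : ∀ {n} {P Q : Fin n → Bool} (x : Fin n) → P ⊆ᵇ Q → P x ≡ false → Q x ≡ true → count P < count Q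
count-⊂ {suc n} {P} {Q} x P⊆Q Px Qx = begin-strict
  count P               ≡⟨ count-punchIn-false P Px ⟩
  count (P ∘ punchIn x) ≤⟨ count-mono (P⊆Q ∘ punchIn x) ⟩
  count (Q ∘ punchIn x) <⟨ n<1+n _ ⟩
  suc (count (Q ∘ punchIn x)) ≡⟨ count-punchIn-true Q Qx ⟨
  count Q               ∎
  where open ≤-Reasoning

count-partition : ∀ {n} {A B : Fin n → Bool} → Disjointᵇ A B →
                  count (λ x → not (A x) ∧ not (B x)) + (count A + count B) ≡ n
count-partition {n} {A} {B} A∩B≡∅ = begin
  count N + (count A + count B)       ≡⟨ cong (count N +_) (∑-distrib-+ 𝟙A 𝟙B) ⟨
  count N + sum (λ x → 𝟙A x + 𝟙B x)  ≡⟨ ∑-distrib-+ 𝟙N (λ x → 𝟙A x + 𝟙B x) ⟨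
  sum (λ x → 𝟙N x + (𝟙A x + 𝟙B x))  ≡⟨ sum-cong-≗ (λ x → exactly-one (A x) (B x) (A∩B≡∅ x)) ⟩
  sum {n} (const 1)                   ≡⟨ count-const n true ⟩
  n                                   ∎
  where
  open ≡-Reasoning
  N : Fin n → Bool
  N x = not (A x) ∧ not (B x)
  𝟙A 𝟙B 𝟙N : Fin n → ℕ
  𝟙A x = if A x then 1 else 0
  𝟙B x = if B x then 1 else 0
  𝟙N x = if N x then 1 else 0
  exactly-one : ∀ a b → (a ≡ true → b ≡ false) →
                (if not a ∧ not b then 1 else 0) + ((if a then 1 else 0) + (if b then 1 else 0)) ≡ 1
  exactly-one true  true  a⇒¬b with () ← a⇒¬b refl
  exactly-one true  false _ = refl
  exactly-one false true  _ = refl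
  exactly-one false false _ = refl

count-disjoint : ∀ {n} {A B : Fin n → Bool} → Disjointᵇ A B → count A + count B ≤ n
count-disjoint {A = A} {B} A∩B≡∅ =
  subst (count A + count B ≤_) (count-partition A∩B≡∅) (m≤n+m _ (count (λ x → not (A x) ∧ not (B x))))

_without_ : ∀ {n} → (Fin n → Bool) → Fin n → (Fin n → Bool)
(P without x) y = P y ∧ not (does (y ≟ x))

without-self : ∀ {n} (P : Fin n → Bool) x → (P without x) x ≡ false
without-self P x = trans (cong (λ b → P x ∧ not b) (dec-true (x ≟ x) refl)) (∧-zeroʳ (P x))

without-≢ : ∀ {n} (P : Fin n → Bool) {x y} → y ≢ x → (P without x) y ≡ P y
without-≢ P {x} {y} y≢x = trans (cong (λ b → P y ∧ not b) (dec-false (y ≟ x) y≢x)) (∧-identityʳ (P y))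

without-⊆ : ∀ {n} (P : Fin n → Bool) x → (P without x) ⊆ᵇ P
without-⊆ P x y P∖xy with P y
... | true = refl

count-without : ∀ {n} (P : Fin n → Bool) {x} → P x ≡ true → count P ≡ suc (count (P without x))
count-without {suc n} P {x} Px = begin
  count P                                 ≡⟨ count-punchIn-true P Px ⟩
  suc (count (P ∘ punchIn x))             ≡⟨ cong suc (sum-cong-≗ away) ⟨
  suc (count ((P without x) ∘ punchIn x)) ≡⟨ cong suc (count-punchIn-false (P without x) (without-self P x)) ⟨
  suc (count (P without x))               ∎
  where
  open ≡-Reasoning
  away : ∀ y → (if (P without x) (punchIn x y) then 1 else 0) ≡ (if P (punchIn x y) then 1 else 0)
  away y = cong (λ b → if b then 1 else 0) (without-≢ P (punchInᵢ≢i x y))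

⊆-count-≡⇒≗ : ∀ {n} {P Q : Fin n → Bool} → P ⊆ᵇ Q → count P ≡ count Q → ∀ x → P x ≡ Q x
⊆-count-≡⇒≗ {P = P} {Q} P⊆Q ∣P∣≡∣Q∣ x with P x in Px | Q x in Qx
... | true  | true  = refl
... | false | false = refl
... | true  | false with () ← trans (sym (P⊆Q x Px)) Qx
... | false | true  = contradiction ∣P∣≡∣Q∣ (<⇒≢ (count-⊂ x P⊆Q Px Qx))

count-+-injection : ∀ {n k} {P R : Fin n → Bool} (g : Fin k → Fin n) → Injective _≡_ _≡_ g →
                    (∀ j → P (g j) ≡ false) → (∀ j → R (g j) ≡ true) → P ⊆ᵇ R → count P + k ≤ count R
count-+-injection {k = zero}  {P} g _ _ _ P⊆R = subst (_≤ _) (sym (+-identityʳ (count P))) (count-mono P⊆R)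
count-+-injection {k = suc k} {P} {R} g g-inj gP gR P⊆R = begin
  count P + suc k   ≡⟨ +-suc (count P) k ⟩
  suc (count P + k) ≤⟨ s≤s (count-+-injection (g ∘ suc) (Fin-suc-injective ∘ g-inj) (gP ∘ suc) gR′ P⊆R′) ⟩
  suc (count R′)    ≡⟨ count-without R (gR zero) ⟨
  count R           ∎
  where
  open ≤-Reasoning
  R′ : Fin _ → Bool
  R′ = R without g zero
  gR′ : ∀ j → R′ (g (suc j)) ≡ true
  gR′ j = trans (without-≢ R (0≢1+n ∘ sym ∘ g-inj)) (gR (suc j))
  P⊆R′ : P ⊆ᵇ R′
  P⊆R′ y Py = trans (without-≢ R y≢g₀) (P⊆R y Py)
    where
    y≢g₀ : y ≢ g zero
    y≢g₀ refl = contradiction (trans (sym Py) (gP zero)) λ ()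

count-enumerate : ∀ {n s} (P : Fin n → Bool) → s ≤ count P →
                  Σ (Fin s → Fin n) λ y → Injective _≡_ _≡_ y × (∀ i → P (y i) ≡ true)
count-enumerate {s = zero} P _ = (λ ()) , (λ { {()} }) , (λ ())
count-enumerate {zero} {suc s} P ()
count-enumerate {suc n} {suc s} P s<∣P∣ with P zero in P0
... | false = let y , y-inj , Py = count-enumerate (P ∘ suc) s<∣P∣
              in suc ∘ y , y-inj ∘ Fin-suc-injective , Py
... | true  = let y , y-inj , Py = count-enumerate (P ∘ suc) (s≤s⁻¹ s<∣P∣)
              in y′ y , y′-inj y-inj , y′-P Py
  where
  y′ : (Fin s → Fin n) → Fin (suc s) → Fin (suc n)
  y′ y zero    = zero
  y′ y (suc i) = suc (y i)
  y′-inj : ∀ {y} → Injective _≡_ _≡_ y → Injective _≡_ _≡_ (y′ y)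
  y′-inj y-inj {zero}  {zero}  _ = refl
  y′-inj y-inj {suc i} {suc j} e = cong suc (y-inj (Fin-suc-injective e))
  y′-P : ∀ {y} → (∀ i → P (suc (y i)) ≡ true) → ∀ i → P (y′ y i) ≡ true
  y′-P Py zero    = P0
  y′-P Py (suc i) = Py i

C-factorial : ∀ {n k} → k ≤ n → (n C k) * (k ! * (n ∸ k) !) ≡ n !
C-factorial {n} {k} k≤n =
  trans (cong (_* (k ! * (n ∸ k) !)) (nCk≡n!/k![n-k]! k≤n)) (m/n*n≡m (k![n∸k]!∣n! k≤n))
  where instance _ = k !* (n ∸ k) !≢0

1≤C : ∀ {n k} → k ≤ n → 1 ≤ n C k
1≤C {n} {k} k≤n = n≢0⇒n>0 λ C≡0 →
  ≢-nonZero⁻¹ (n !) {{n !≢0}} (trans (sym (C-factorial k≤n)) (cong (_* (k ! * (n ∸ k) !)) C≡0))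

C-∣-! : ∀ {n k} → k ≤ n → n C k ∣ n !
C-∣-! {n} {k} k≤n = subst (n C k ∣_) (C-factorial k≤n) (m∣m*n _)

!-∣-! : ∀ {m n} → m ≤ n → m ! ∣ n !
!-∣-! {m} m≤n = ∣-trans (m∣m*n _) (k![n∸k]!∣n! m≤n)

C-swap : ∀ a b → (a + b) C b ≡ (a + b) C a
C-swap a b = trans (nCk≡nC[n∸k] (m≤n+m b a)) (cong ((a + b) C_) (m+n∸n≡m a b))

C-≤-suc : ∀ n k → n C k ≤ suc n C k
C-≤-suc n zero    = ≤-refl
C-≤-suc n (suc k) = subst (n C suc k ≤_) (nCk+nC[k+1]≡[n+1]C[k+1] n k) (m≤n+m _ _)

C-monoˡ-≤ : ∀ {m n} k → m ≤ n → m C k ≤ n C k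
C-monoˡ-≤ k = mono ∘ ≤⇒≤′
  where
  mono : ∀ {m n} → m ≤′ n → m C k ≤ n C k
  mono ≤′-refl        = ≤-refl
  mono (≤′-step m≤′n) = ≤-trans (mono m≤′n) (C-≤-suc _ k)

C-absorb : ∀ n k → suc k * (suc n C suc k) ≡ suc n * (n C k)
C-absorb n k with k ≤? n
... | no k≰n = begin
  suc k * (suc n C suc k) ≡⟨ cong (suc k *_) (k>n⇒nCk≡0 (s≤s (≰⇒> k≰n))) ⟩
  suc k * 0               ≡⟨ *-zeroʳ (suc k) ⟩
  0                       ≡⟨ *-zeroʳ (suc n) ⟨
  suc n * 0               ≡⟨ cong (suc n *_) (k>n⇒nCk≡0 (≰⇒> k≰n)) ⟨
  suc n * (n C k)         ∎
  where open ≡-Reasoning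
... | yes k≤n = *-cancelʳ-≡ _ _ (k ! * (n ∸ k) !) (begin
  suc k * (suc n C suc k) * (k ! * (n ∸ k) !)     ≡⟨ shuffle (suc k) (suc n C suc k) (k !) ((n ∸ k) !) ⟩
  (suc n C suc k) * (suc k ! * (suc n ∸ suc k) !) ≡⟨ C-factorial (s≤s k≤n) ⟩
  suc n * n !                                     ≡⟨ cong (suc n *_) (C-factorial k≤n) ⟨
  suc n * ((n C k) * (k ! * (n ∸ k) !))           ≡⟨ *-assoc (suc n) (n C k) _ ⟨
  suc n * (n C k) * (k ! * (n ∸ k) !)             ∎)
  where
  open ≡-Reasoning
  instance _ = k !* (n ∸ k) !≢0
  shuffle : ∀ x c f d → x * c * (f * d) ≡ c * (x * f * d)
  shuffle = solve-∀

C-nonZero : ∀ a b → NonZero ((a + b) C b)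
C-nonZero a b = >-nonZero (1≤C (m≤n+m b a))

-- n ! / C(a + b, b) is the number of orderings of an n-set in which a fixed a-set comes
-- before a fixed disjoint b-set; the division is exact only when a + b ≤ n.
opaque
  weight : ℕ → ℕ → ℕ → ℕ
  weight n a b = (n ! / ((a + b) C b)) {{C-nonZero a b}}

  weight-*-C : ∀ {n a b} → a + b ≤ n → weight n a b * ((a + b) C b) ≡ n !
  weight-*-C {n} {a} {b} a+b≤n = m/n*n≡m {{C-nonZero a b}} (∣-trans (C-∣-! (m≤n+m b a)) (!-∣-! a+b≤n))

1≤weight : ∀ {n a b} → a + b ≤ n → 1 ≤ weight n a b
1≤weight {n} {a} {b} a+b≤n = n≢0⇒n>0 λ w≡0 →
  ≢-nonZero⁻¹ (n !) {{n !≢0}} (trans (sym (weight-*-C a+b≤n)) (cong (_* ((a + b) C b)) w≡0))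

weight≤! : ∀ {n a b} → a + b ≤ n → weight n a b ≤ n !
weight≤! {n} {a} {b} a+b≤n = subst (weight n a b ≤_) (weight-*-C a+b≤n) (m≤m*n _ _ {{C-nonZero a b}})

weight-antitone : ∀ {n a b b′} → b′ ≤ b → a + b ≤ n → weight n a b ≤ weight n a b′
weight-antitone {n} {a} {b} {b′} b′≤b a+b≤n = *-cancelʳ-≤ _ _ ((a + b) C b) {{C-nonZero a b}} (begin
  weight n a b * ((a + b) C b)   ≡⟨ weight-*-C a+b≤n ⟩
  n !                            ≡⟨ weight-*-C (≤-trans (+-monoʳ-≤ a b′≤b) a+b≤n) ⟨
  weight n a b′ * ((a + b′) C b′) ≤⟨ *-monoʳ-≤ (weight n a b′) C′≤C ⟩
  weight n a b′ * ((a + b) C b)  ∎)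
  where
  open ≤-Reasoning
  C′≤C : (a + b′) C b′ ≤ (a + b) C b
  C′≤C = begin
    (a + b′) C b′ ≡⟨ C-swap a b′ ⟩
    (a + b′) C a  ≤⟨ C-monoˡ-≤ a (+-monoʳ-≤ a b′≤b) ⟩
    (a + b) C a   ≡⟨ C-swap a b ⟨
    (a + b) C b   ∎

weight-recurrence : ∀ {m a b} c → c + (a + suc b) ≡ suc m →
                    weight (suc m) a (suc b) ≡ c * weight m a (suc b) + suc b * weight m a b
weight-recurrence {m} {a} {b} c c+a+b+1≡m+1 = *-cancelʳ-≡ _ _ K {{C-nonZero a (suc b)}} (begin
  weight (suc m) a (suc b) * K    ≡⟨ weight-*-C (subst (a + suc b ≤_) c+a+b+1≡m+1 (m≤n+m _ c)) ⟩
  suc m !                          ≡⟨ cong (_* m !) c+a+b+1≡m+1 ⟨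
  (c + (a + suc b)) * m !          ≡⟨ *-distribʳ-+ (m !) c (a + suc b) ⟩
  c * m ! + (a + suc b) * m !      ≡⟨ cong₂ _+_ (outside-term c (cong pred c+a+b+1≡m+1)) inside-term ⟨
  c * W₁ * K + suc b * W₀ * K      ≡⟨ *-distribʳ-+ K (c * W₁) (suc b * W₀) ⟨
  (c * W₁ + suc b * W₀) * K        ∎)
  where
  open ≡-Reasoning
  K = (a + suc b) C suc b
  W₁ = weight m a (suc b)
  W₀ = weight m a b
  outside-term : ∀ c → pred (c + (a + suc b)) ≡ m → c * W₁ * K ≡ c * m !
  outside-term zero    _  = refl
  outside-term (suc c) eq = trans (*-assoc (suc c) W₁ K) (cong (suc c *_) (weight-*-C (subst (a + suc b ≤_) eq (m≤n+m _ c))))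
  inside-term : suc b * W₀ * K ≡ (a + suc b) * m !
  inside-term = begin
    suc b * W₀ * K                        ≡⟨ cong (λ x → suc b * W₀ * (x C suc b)) (+-suc a b) ⟩
    suc b * W₀ * (suc (a + b) C suc b)    ≡⟨ swap-left (suc b) W₀ _ ⟩
    W₀ * (suc b * (suc (a + b) C suc b))  ≡⟨ cong (W₀ *_) (C-absorb (a + b) b) ⟩
    W₀ * (suc (a + b) * ((a + b) C b))    ≡⟨ swap-right W₀ (suc (a + b)) _ ⟩
    suc (a + b) * (W₀ * ((a + b) C b))    ≡⟨ cong (suc (a + b) *_) (weight-*-C a+b≤m) ⟩
    suc (a + b) * m !                     ≡⟨ cong (_* m !) (+-suc a b) ⟨
    (a + suc b) * m !                     ∎
    where
    swap-left : ∀ x y z → x * y * z ≡ y * (x * z)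
    swap-left = solve-∀
    swap-right : ∀ x y z → x * (y * z) ≡ y * (x * z)
    swap-right = solve-∀
    a+b≤m : a + b ≤ m
    a+b≤m = s≤s⁻¹ (subst₂ _≤_ (+-suc a b) c+a+b+1≡m+1 (m≤n+m _ c))

weight-≡-∑-deletions : ∀ {m b} {A B : Fin (suc m) → Bool} → Disjointᵇ A B → count B ≡ suc b →
  weight (suc m) (count A) (suc b) ≡
  sum (λ x → if not (A x) then weight m (count (A ∘ punchIn x)) (count (B ∘ punchIn x)) else 0)
weight-≡-∑-deletions {m} {b} {A} {B} A∩B≡∅ ∣B∣≡1+b = begin
  weight (suc m) a (suc b)                  ≡⟨ weight-recurrence (count N) partition ⟩
  count N * W₁ + suc b * W₀                 ≡⟨ cong (λ c → count N * W₁ + c * W₀) ∣B∣≡1+b ⟨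
  count N * W₁ + count B * W₀               ≡⟨ cong₂ _+_ (sum-if-const N W₁) (sum-if-const B W₀) ⟨
  sum outside-A∪B + sum inside-B            ≡⟨ ∑-distrib-+ outside-A∪B inside-B ⟨
  sum (λ x → outside-A∪B x + inside-B x)    ≡⟨ sum-cong-≗ deletion-term ⟨
  sum (λ x → if not (A x) then weight m (count (A ∘ punchIn x)) (count (B ∘ punchIn x)) else 0) ∎
  where
  open ≡-Reasoning
  a = count A
  W₁ = weight m a (suc b)
  W₀ = weight m a b
  N : Fin (suc m) → Bool
  N x = not (A x) ∧ not (B x)
  outside-A∪B inside-B : Fin (suc m) → ℕ
  outside-A∪B x = if N x then W₁ else 0
  inside-B x = if B x then W₀ else 0
  partition : count N + (a + suc b) ≡ suc m
  partition = trans (cong (λ c → count N + (a + c)) (sym ∣B∣≡1+b)) (count-partition A∩B≡∅)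
  deletion-term : ∀ x → (if not (A x) then weight m (count (A ∘ punchIn x)) (count (B ∘ punchIn x)) else 0) ≡
                        outside-A∪B x + inside-B x
  deletion-term x with A x in Ax | B x in Bx
  ... | true  | true  with () ← trans (sym (A∩B≡∅ x Ax)) Bx
  ... | true  | false = refl
  ... | false | false = trans (cong₂ (weight m) (sym (count-punchIn-false A Ax)) (trans (sym (count-punchIn-false B Bx)) ∣B∣≡1+b))
                              (sym (+-identityʳ W₁))
  ... | false | true  = cong₂ (weight m) (sym (count-punchIn-false A Ax))
                              (suc-injective (trans (sym (count-punchIn-true B Bx)) ∣B∣≡1+b))

-- The family {(A k , B k) | member k ≡ true}: deleting a point only changes `member`.
record SetPairSystem (M n : ℕ) : Set where
  field
    member   : Fin M → Bool
    A B      : Fin M → Fin n → Bool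
    disjoint : ∀ {k} → member k ≡ true → Disjointᵇ (A k) (B k)
    cross    : ∀ {k l} → member k ≡ true → member l ≡ true → k ≢ l → Meetsᵇ (A k) (B l)

  totalWeight : ℕ
  totalWeight = sum λ k → if member k then weight n (count (A k)) (count (B k)) else 0

open SetPairSystem

deletePoint : ∀ {M m} → SetPairSystem M (suc m) → Fin (suc m) → SetPairSystem M m
deletePoint F x = record
  { member   = λ k → member F k ∧ not (A F k x)
  ; A        = λ k → A F k ∘ punchIn x
  ; B        = λ k → B F k ∘ punchIn x
  ; disjoint = λ {k} mk y → disjoint F (member-of mk) (punchIn x y)
  ; cross    = λ {k} {l} mk ml k≢l → cross-avoiding (member-avoids mk) (cross F (member-of mk) (member-of ml) k≢l)
  }
  where
  member-of : ∀ {k} → member F k ∧ not (A F k x) ≡ true → member F k ≡ true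
  member-of {k} mk with member F k
  ... | true = refl
  member-avoids : ∀ {k} → member F k ∧ not (A F k x) ≡ true → A F k x ≡ false
  member-avoids {k} mk with member F k | A F k x
  ... | true | false = refl
  cross-avoiding : ∀ {k l} → A F k x ≡ false → Meetsᵇ (A F k) (B F l) →
                   Meetsᵇ (A F k ∘ punchIn x) (B F l ∘ punchIn x)
  cross-avoiding {k} {l} Akx≡false (z , Akz , Blz) = punchOut x≢z , at-z (A F k) Akz , at-z (B F l) Blz
    where
    x≢z : x ≢ z
    x≢z refl with () ← trans (sym Akx≡false) Akz
    at-z : ∀ (P : Fin _ → Bool) → P z ≡ true → P (punchIn x (punchOut x≢z)) ≡ true
    at-z P = subst (λ y → P y ≡ true) (sym (punchIn-punchOut x≢z))

totalWeight-lonely≤! : ∀ {M n} (F : SetPairSystem M n) {k} → member F k ≡ true → (∀ x → B F k x ≡ false) →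
                       totalWeight F ≤ n !
totalWeight-lonely≤! {n = n} F {k} mk Bk≡∅ =
  subst (_≤ n !) (sym (sum-concentrated _ k others-vanish)) lonely-term
  where
  others-vanish : ∀ l → l ≢ k → (if member F l then weight n (count (A F l)) (count (B F l)) else 0) ≡ 0
  others-vanish l l≢k with member F l in ml
  ... | false = refl
  ... | true with z , _ , Bkz ← cross F ml mk l≢k with () ← trans (sym (Bk≡∅ z)) Bkz
  lonely-term : (if member F k then weight n (count (A F k)) (count (B F k)) else 0) ≤ n !
  lonely-term with member F k in mk′
  ... | true  = weight≤! (count-disjoint (disjoint F mk′))
  ... | false = z≤n

totalWeight-≡-∑-deletions : ∀ {M m} (F : SetPairSystem M (suc m)) →
                            (∀ {k} → member F k ≡ true → Nonemptyᵇ (B F k)) →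
                            totalWeight F ≡ sum (λ x → totalWeight (deletePoint F x))
totalWeight-≡-∑-deletions {M} {m} F B-point = begin
  totalWeight F                             ≡⟨ sum-cong-≗ split-term ⟩
  sum (λ k → sum (λ x → term k x))          ≡⟨ ∑-comm term ⟩
  sum (λ x → totalWeight (deletePoint F x)) ∎
  where
  open ≡-Reasoning
  term : Fin M → Fin (suc m) → ℕ
  term k x = if member F k ∧ not (A F k x) then weight m (count (A F k ∘ punchIn x)) (count (B F k ∘ punchIn x)) else 0
  split-term : ∀ k → (if member F k then weight (suc m) (count (A F k)) (count (B F k)) else 0) ≡ sum (term k)
  split-term k with member F k in mk
  ... | false = sym (sum-zero (suc m))
  ... | true  with x , Bkx ← B-point mk =
    trans (cong (weight (suc m) (count (A F k))) ∣B∣≡1+b) (weight-≡-∑-deletions (disjoint F mk) ∣B∣≡1+b)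
    where
    ∣B∣≡1+b : count (B F k) ≡ suc (count (B F k ∘ punchIn x))
    ∣B∣≡1+b = count-punchIn-true (B F k) Bkx

-- A member with empty B excludes all others; otherwise every B is nonempty and the
-- point-deletion recurrence applies.
totalWeight≤! : ∀ {M n} (F : SetPairSystem M n) → totalWeight F ≤ n !
totalWeight-crowded≤! : ∀ {M n} (F : SetPairSystem M n) →
                        (∀ {k} → member F k ≡ true → Nonemptyᵇ (B F k)) → totalWeight F ≤ n !

totalWeight≤! {n = n} F with any? (λ k → (member F k ≟ᵇ true) ×-dec all? (λ x → B F k x ≟ᵇ false))
... | yes (k , mk , Bk≡∅) = totalWeight-lonely≤! F mk Bk≡∅
... | no ¬lonely          = totalWeight-crowded≤! F B-point
  where
  B-point : ∀ {k} → member F k ≡ true → Nonemptyᵇ (B F k)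
  B-point {k} mk with x , Bkx≢false ← ¬∀⟶∃¬ n _ (λ x → B F k x ≟ᵇ false) (λ Bk≡∅ → ¬lonely (k , mk , Bk≡∅)) =
    x , ¬-not Bkx≢false

totalWeight-crowded≤! {M} {zero} F B-point = begin
  totalWeight F         ≡⟨ sum-cong-≗ no-member ⟩
  sum {M} (const 0)     ≡⟨ sum-zero M ⟩
  0                     <⟨ z<s ⟩
  1                     ∎
  where
  open ≤-Reasoning
  no-member : ∀ k → (if member F k then weight 0 (count (A F k)) (count (B F k)) else 0) ≡ 0
  no-member k with member F k in mk
  ... | false = refl
  ... | true with () ← B-point mk
totalWeight-crowded≤! {M} {suc m} F B-point = begin
  totalWeight F                              ≡⟨ totalWeight-≡-∑-deletions F B-point ⟩
  sum (λ x → totalWeight (deletePoint F x))  ≤⟨ sum-mono-≤ (λ x → totalWeight≤! (deletePoint F x)) ⟩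
  sum {suc m} (const (m !))                  ≡⟨ sum-const (suc m) (m !) ⟩
  suc m !                                    ∎
  where open ≤-Reasoning

bollobas : ∀ {M n a b} (F : SetPairSystem M n) →
           (∀ {k} → member F k ≡ true → count (A F k) ≡ a) →
           (∀ {k} → member F k ≡ true → count (B F k) ≤ b) →
           count (member F) ≤ (a + b) C a
bollobas {M} {n} {a} {b} F ∣A∣≡a ∣B∣≤b with a ≤? n
... | no a≰n = begin
  count (member F)        ≤⟨ count-mono {Q = const false} no-member ⟩
  count {M} (const false) ≡⟨ count-const M false ⟩
  0                       ≤⟨ z≤n ⟩
  (a + b) C a             ∎
  where
  open ≤-Reasoning
  no-member : member F ⊆ᵇ const false
  no-member k mk = contradiction (subst (_≤ n) (∣A∣≡a mk) (count≤n (A F k))) a≰n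
... | yes a≤n = begin
  count (member F)  ≤⟨ *-cancelʳ-≤ _ _ w₀ {{>-nonZero (1≤weight a+b₀≤n)}} weighted-count ⟩
  (a + b₀) C b₀     ≡⟨ C-swap a b₀ ⟩
  (a + b₀) C a      ≤⟨ C-monoˡ-≤ a (+-monoʳ-≤ a (m⊓n≤m b (n ∸ a))) ⟩
  (a + b) C a       ∎
  where
  open ≤-Reasoning
  -- every |B k| is at most n - a, and clamping b there makes the weight exact
  b₀ = b ⊓ (n ∸ a)
  a+b₀≤n : a + b₀ ≤ n
  a+b₀≤n = subst (a + b₀ ≤_) (m+[n∸m]≡n a≤n) (+-monoʳ-≤ a (m⊓n≤n b (n ∸ a)))
  w₀ = weight n a b₀
  ∣B∣≤b₀ : ∀ {k} → member F k ≡ true → count (B F k) ≤ b₀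
  ∣B∣≤b₀ {k} mk = ⊓-glb (∣B∣≤b mk) (begin
    count (B F k)         ≡⟨ m+n∸m≡n a (count (B F k)) ⟨
    a + count (B F k) ∸ a ≤⟨ ∸-monoˡ-≤ a (subst (λ c → c + count (B F k) ≤ n) (∣A∣≡a mk) (count-disjoint (disjoint F mk))) ⟩
    n ∸ a                 ∎)
  lightest : ∀ k → (if member F k then w₀ else 0) ≤ (if member F k then weight n (count (A F k)) (count (B F k)) else 0)
  lightest k with member F k in mk
  ... | false = z≤n
  ... | true  = subst (λ c → w₀ ≤ weight n c (count (B F k))) (sym (∣A∣≡a mk)) (weight-antitone (∣B∣≤b₀ mk) a+b₀≤n)
  weighted-count : count (member F) * w₀ ≤ ((a + b₀) C b₀) * w₀
  weighted-count = begin
    count (member F) * w₀                     ≡⟨ sum-if-const (member F) w₀ ⟨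
    sum (λ k → if member F k then w₀ else 0)  ≤⟨ sum-mono-≤ lightest ⟩
    totalWeight F                             ≤⟨ totalWeight≤! F ⟩
    n !                                       ≡⟨ weight-*-C a+b₀≤n ⟨
    w₀ * ((a + b₀) C b₀)                      ≡⟨ *-comm w₀ _ ⟩
    ((a + b₀) C b₀) * w₀                      ∎

∣∣≡count : ∀ {n} (p : Subset n) → ∣ p ∣ₛ ≡ count (lookup p)
∣∣≡count []          = refl
∣∣≡count (true ∷ p)  = cong suc (∣∣≡count p)
∣∣≡count (false ∷ p) = ∣∣≡count p

lookup-≗⇒≡ : ∀ {n} {A : Set} {u v : Vec A n} → (∀ x → lookup u x ≡ lookup v x) → u ≡ v
lookup-≗⇒≡ {u = u} {v} u≗v = trans (sym (tabulate∘lookup u)) (trans (tabulate-cong u≗v) (tabulate∘lookup v))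

Unique-lookup-injective : ∀ {A : Set} {xs : List A} → Unique xs → ∀ {i j} → lookupₗ xs i ≡ lookupₗ xs j → i ≡ j
Unique-lookup-injective {xs = x ∷ xs} _ {zero}  {zero}  _ = refl
Unique-lookup-injective {xs = x ∷ xs} (x∉xs ∷ _) {zero}  {suc j} x≡xsⱼ = contradiction x≡xsⱼ (All.lookup x∉xs (∈-lookup j))
Unique-lookup-injective {xs = x ∷ xs} (x∉xs ∷ _) {suc i} {zero}  xsᵢ≡x = contradiction (sym xsᵢ≡x) (All.lookup x∉xs (∈-lookup i))
Unique-lookup-injective {xs = x ∷ xs} (_ ∷ u)    {suc i} {suc j} xsᵢ≡xsⱼ = cong suc (Unique-lookup-injective u xsᵢ≡xsⱼ)

module _ {r n} (H : Hypergraph r n) where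

  incidence : Fin (numEdges H) → Fin n → Bool
  incidence k = lookup (lookupₗ (edges H) k)

  count-incidence : ∀ k → count (incidence k) ≡ r
  count-incidence k = trans (sym (∣∣≡count (lookupₗ (edges H) k))) (All.lookup (uniform H) (∈-lookup k))

  incidence-injective : ∀ {k l} → (∀ x → incidence k x ≡ incidence l x) → k ≡ l
  incidence-injective k≗l = Unique-lookup-injective (unique H) (lookup-≗⇒≡ k≗l)

  inducedStar : ∀ {s} (v : Fin n) (y : Fin s → Fin n) (f : Fin s → Fin (numEdges H)) →
                Injective _≡_ _≡_ y → (∀ i → y i ≢ v) →
                (∀ i → incidence (f i) v ≡ true) → (∀ i → incidence (f i) (y i) ≡ true) →
                (∀ i j → incidence (f i) (y j) ≡ true → j ≡ i) → InducedBerge (Star s) H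
  inducedStar {s} v y f y-inj y≢v f∋v f∋y f∌y = w , f , w-inj , f-inj , λ i x → mk⇔ (to i x) (from i x)
    where
    w : Fin (suc s) → Fin n
    w zero    = v
    w (suc i) = y i
    w-inj : Injective _≡_ _≡_ w
    w-inj {zero}  {zero}  _ = refl
    w-inj {zero}  {suc j} v≡yⱼ = contradiction (sym v≡yⱼ) (y≢v j)
    w-inj {suc i} {zero}  yᵢ≡v = contradiction yᵢ≡v (y≢v i)
    w-inj {suc i} {suc j} yᵢ≡yⱼ = cong suc (y-inj yᵢ≡yⱼ)
    f-inj : Injective _≡_ _≡_ f
    f-inj {i} {j} fᵢ≡fⱼ = f∌y j i (subst (λ k → incidence k (y i) ≡ true) fᵢ≡fⱼ (f∋y i))
    to : ∀ i x → w x ∈ₛ lookupₗ (edges H) (f i) → x ≡ zero ⊎ x ≡ suc i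
    to i zero    _ = inj₁ refl
    to i (suc j) yⱼ∈fᵢ = inj₂ (cong suc (f∌y i j ([]=⇒lookup yⱼ∈fᵢ)))
    from : ∀ i x → x ≡ zero ⊎ x ≡ suc i → w x ∈ₛ lookupₗ (edges H) (f i)
    from i .zero    (inj₁ refl) = lookup⇒[]= v _ (f∋v i)
    from i .(suc i) (inj₂ refl) = lookup⇒[]= (y i) _ (f∋y i)

module Transversal {L n} (F : Fin L → Bool) (S : Fin L → Fin n → Bool) where

  IsTransversal : (Fin n → Bool) → Set
  IsTransversal T = ∀ k → F k ≡ true → Meetsᵇ (S k) T

  meets? : ∀ T k → Dec (F k ≡ true → Meetsᵇ (S k) T)
  meets? T k = (F k ≟ᵇ true) →-dec any? (λ x → (S k x ≟ᵇ true) ×-dec (T x ≟ᵇ true))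

  HasPrivateEdge : (Fin n → Bool) → Fin n → Set
  HasPrivateEdge T y = ∃ λ k → F k ≡ true × (∀ z → T z ≡ true → S k z ≡ true → z ≡ y)

  -- Each y is dropped if what remains still meets every S k; a point that survives was
  -- needed at its turn, and the witnessing S k stays private to it as T only shrinks.
  prune : List (Fin n) → (Fin n → Bool) → (Fin n → Bool)
  prune []       T = T
  prune (y ∷ ys) T with all? (meets? (T without y))
  ... | yes _ = prune ys (T without y)
  ... | no  _ = prune ys T

  prune-⊆ : ∀ ys T → prune ys T ⊆ᵇ T
  prune-⊆ []       T z Tz = Tz
  prune-⊆ (y ∷ ys) T z pz with all? (meets? (T without y))
  ... | yes _ = without-⊆ T y z (prune-⊆ ys (T without y) z pz)
  ... | no  _ = prune-⊆ ys T z pz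

  prune-transversal : ∀ ys {T} → IsTransversal T → IsTransversal (prune ys T)
  prune-transversal []       T-tr = T-tr
  prune-transversal (y ∷ ys) {T} T-tr with all? (meets? (T without y))
  ... | yes T∖y-tr = prune-transversal ys T∖y-tr
  ... | no  _      = prune-transversal ys T-tr

  prune-private : ∀ {ys T y} → y ∈ ys → prune ys T y ≡ true → HasPrivateEdge (prune ys T) y
  prune-private {y′ ∷ ys} {T} (there y∈ys) py with all? (meets? (T without y′))
  ... | yes _ = prune-private y∈ys py
  ... | no  _ = prune-private y∈ys py
  prune-private {y ∷ ys} {T} (here refl) py with all? (meets? (T without y))
  ... | yes _ = contradiction (trans (sym (prune-⊆ ys (T without y) y py)) (without-self T y)) λ ()
  ... | no ¬T∖y-tr with k , ¬meets ← ¬∀⟶∃¬ L _ (meets? (T without y)) ¬T∖y-tr = k , Fk , only-y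
    where
    Fk : F k ≡ true
    Fk = ¬-not λ Fk≡false → ¬meets λ Fk≡true → contradiction (trans (sym Fk≡false) Fk≡true) λ ()
    only-y : ∀ z → prune ys T z ≡ true → S k z ≡ true → z ≡ y
    only-y z pz Skz with z ≟ y
    ... | yes z≡y = z≡y
    ... | no  z≢y = contradiction (λ _ → z , Skz , trans (without-≢ T z≢y) (prune-⊆ ys T z pz)) ¬meets

  minimal : (Fin n → Bool) → (Fin n → Bool)
  minimal = prune (allFin n)

  minimal-⊆ : ∀ T → minimal T ⊆ᵇ T
  minimal-⊆ = prune-⊆ (allFin n)

  minimal-transversal : ∀ {T} → IsTransversal T → IsTransversal (minimal T)
  minimal-transversal = prune-transversal (allFin n)

  minimal-private : ∀ {T y} → minimal T y ≡ true → HasPrivateEdge (minimal T) y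
  minimal-private = prune-private (∈-allFin _)

module StarFreeDegree {r n s} (H : Hypergraph r n) (star-free : ¬ InducedBerge (Star (suc s)) H) (v : Fin n) where

  open Transversal using (IsTransversal; minimal; minimal-⊆; minimal-transversal; minimal-private)

  through-v : Fin (numEdges H) → Bool
  through-v l = incidence H l v

  others : Fin (numEdges H) → Fin (numEdges H) → Bool
  others k = through-v without k

  others-∋ : ∀ {k l} → incidence H l v ≡ true → l ≢ k → others k l ≡ true
  others-∋ lv l≢k = trans (without-≢ through-v l≢k) lv

  others-∋v : ∀ {k l} → others k l ≡ true → incidence H l v ≡ true
  others-∋v {k} {l} = without-⊆ through-v k l

  others-≢ : ∀ {k l} → others k l ≡ true → l ≢ k
  others-≢ {k} kl refl = contradiction (trans (sym kl) (without-self through-v k)) λ ()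

  outside : Fin (numEdges H) → Fin n → Bool
  outside k = not ∘ incidence H k

  outside-transversal : ∀ k → IsTransversal (others k) (incidence H) (outside k)
  outside-transversal k l kl with any? (λ x → (incidence H l x ≟ᵇ true) ×-dec (outside k x ≟ᵇ true))
  ... | yes l∖k≢∅ = l∖k≢∅
  ... | no  l⊆k   = contradiction l≡k (others-≢ kl)
    where
    l⊆ᵇk : incidence H l ⊆ᵇ incidence H k
    l⊆ᵇk x lx with incidence H k x in kx
    ... | true  = refl
    ... | false = contradiction (x , lx , cong not kx) l⊆k
    l≡k : l ≡ k
    l≡k = incidence-injective H (⊆-count-≡⇒≗ l⊆ᵇk (trans (count-incidence H l) (sym (count-incidence H k))))

  transversal : Fin (numEdges H) → Fin n → Bool
  transversal k = minimal (others k) (incidence H) (outside k)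

  transversal-⊆ : ∀ k → transversal k ⊆ᵇ outside k
  transversal-⊆ k = minimal-⊆ (others k) (incidence H) (outside k)

  transversal-transversal : ∀ k → IsTransversal (others k) (incidence H) (transversal k)
  transversal-transversal k = minimal-transversal (others k) (incidence H) (outside-transversal k)

  transversal-outside : ∀ {k x} → transversal k x ≡ true → incidence H k x ≡ false
  transversal-outside {k} {x} Tx = not-injective (transversal-⊆ k x Tx)

  system : SetPairSystem (numEdges H) n
  system = record
    { member   = through-v
    ; A        = λ k → incidence H k without v
    ; B        = transversal
    ; disjoint = λ {k} _ → A-disjoint k
    ; cross    = A-B-cross
    }
    where
    A-disjoint : ∀ k → Disjointᵇ (incidence H k without v) (transversal k)
    A-disjoint k x Akx with transversal k x in Tkx
    ... | false = refl
    ... | true  = contradiction (trans (sym (without-⊆ (incidence H k) v x Akx)) (transversal-outside Tkx)) λ ()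
    A-B-cross : ∀ {k l} → incidence H k v ≡ true → incidence H l v ≡ true → k ≢ l →
                Meetsᵇ (incidence H k without v) (transversal l)
    A-B-cross {k} {l} kv lv k≢l with x , kx , Tlx ← transversal-transversal l k (others-∋ kv k≢l) =
      x , trans (without-≢ (incidence H k) x≢v) kx , Tlx
      where
      x≢v : x ≢ v
      x≢v refl = contradiction (trans (sym lv) (transversal-outside Tlx)) λ ()

  ∣A∣≡r-1 : ∀ {k} → incidence H k v ≡ true → count (incidence H k without v) ≡ r ∸ 1
  ∣A∣≡r-1 {k} kv = cong (_∸ 1) (trans (sym (count-without (incidence H k) kv)) (count-incidence H k))

  ∣B∣≤s : ∀ {k} → incidence H k v ≡ true → count (transversal k) ≤ s
  ∣B∣≤s {k} kv with s <? count (transversal k)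
  ... | no  ∣B∣≯s = ≮⇒≥ ∣B∣≯s
  ... | yes ∣B∣>s with y , y-inj , Ty ← count-enumerate (transversal k) ∣B∣>s =
    contradiction (inducedStar H v y f y-inj y≢v f∋v f∋y f∌y) star-free
    where
    f : Fin (suc s) → Fin (numEdges H)
    f i = proj₁ (minimal-private (others k) (incidence H) (Ty i))
    f-other : ∀ i → others k (f i) ≡ true
    f-other i = proj₁ (proj₂ (minimal-private (others k) (incidence H) (Ty i)))
    f-private : ∀ i z → transversal k z ≡ true → incidence H (f i) z ≡ true → z ≡ y i
    f-private i = proj₂ (proj₂ (minimal-private (others k) (incidence H) (Ty i)))
    y≢v : ∀ i → y i ≢ v
    y≢v i refl = contradiction (trans (sym kv) (transversal-outside (Ty i))) λ ()
    f∋v : ∀ i → incidence H (f i) v ≡ true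
    f∋v i = others-∋v (f-other i)
    f∋y : ∀ i → incidence H (f i) (y i) ≡ true
    f∋y i with z , fz , Tz ← transversal-transversal k (f i) (f-other i) =
      subst (λ z → incidence H (f i) z ≡ true) (f-private i z Tz fz) fz
    f∌y : ∀ i j → incidence H (f i) (y j) ≡ true → j ≡ i
    f∌y i j fyⱼ = y-inj (f-private i (y j) (Ty j) fyⱼ)

  degree-bound : count through-v ≤ (r ∸ 1 + s) C (r ∸ 1)
  degree-bound = bollobas system ∣A∣≡r-1 ∣B∣≤s

upper-bound : ∀ {r n s} (H : Hypergraph r n) → ¬ InducedBerge (Star (suc s)) H →
              r * numEdges H ≤ n * ((r ∸ 1 + s) C (r ∸ 1))
upper-bound {r} {n} {s} H star-free = begin
  r * numEdges H                            ≡⟨ *-comm r (numEdges H) ⟩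
  numEdges H * r                            ≡⟨ sum-const (numEdges H) r ⟨
  sum {numEdges H} (const r)                ≡⟨ sum-cong-≗ (sym ∘ count-incidence H) ⟩
  sum (λ k → count (incidence H k))         ≡⟨ ∑-comm (λ k x → if incidence H k x then 1 else 0) ⟩
  sum (λ x → count (λ k → incidence H k x)) ≤⟨ sum-mono-≤ (StarFreeDegree.degree-bound H star-free) ⟩
  sum {n} (const ((r ∸ 1 + s) C (r ∸ 1)))   ≡⟨ sum-const n _ ⟩
  n * ((r ∸ 1 + s) C (r ∸ 1))               ∎
  where open ≤-Reasoning

subsetsOfSize : (q k : ℕ) → List (Subset q)
subsetsOfSize zero    zero    = [] ∷ []
subsetsOfSize zero    (suc k) = []
subsetsOfSize (suc q) zero    = map (false ∷_) (subsetsOfSize q zero)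
subsetsOfSize (suc q) (suc k) = map (true ∷_) (subsetsOfSize q k) ++ₗ map (false ∷_) (subsetsOfSize q (suc k))

length-subsetsOfSize : ∀ q k → length (subsetsOfSize q k) ≡ q C k
length-subsetsOfSize zero    zero    = refl
length-subsetsOfSize zero    (suc k) = refl
length-subsetsOfSize (suc q) zero    = trans (length-map _ (subsetsOfSize q zero)) (length-subsetsOfSize q zero)
length-subsetsOfSize (suc q) (suc k) = begin
  length (map (true ∷_) (subsetsOfSize q k) ++ₗ map (false ∷_) (subsetsOfSize q (suc k)))
    ≡⟨ length-++ (map (true ∷_) (subsetsOfSize q k)) ⟩
  length (map (true ∷_) (subsetsOfSize q k)) + length (map (false ∷_) (subsetsOfSize q (suc k)))
    ≡⟨ cong₂ _+_ (length-map _ (subsetsOfSize q k)) (length-map _ (subsetsOfSize q (suc k))) ⟩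
  length (subsetsOfSize q k) + length (subsetsOfSize q (suc k))
    ≡⟨ cong₂ _+_ (length-subsetsOfSize q k) (length-subsetsOfSize q (suc k)) ⟩
  q C k + q C suc k
    ≡⟨ nCk+nC[k+1]≡[n+1]C[k+1] q k ⟩
  suc q C suc k ∎
  where open ≡-Reasoning

subsetsOfSize-unique : ∀ q k → Unique (subsetsOfSize q k)
subsetsOfSize-unique zero    zero    = All.[] ∷ []
subsetsOfSize-unique zero    (suc k) = []
subsetsOfSize-unique (suc q) zero    = Unique.map⁺ ∷-injectiveʳ (subsetsOfSize-unique q zero)
subsetsOfSize-unique (suc q) (suc k) =
  Unique.++⁺ (Unique.map⁺ ∷-injectiveʳ (subsetsOfSize-unique q k))
             (Unique.map⁺ ∷-injectiveʳ (subsetsOfSize-unique q (suc k)))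
             λ (∈true , ∈false) → heads-differ (∈-map⁻ (true ∷_) ∈true) (∈-map⁻ (false ∷_) ∈false)
  where
  heads-differ : ∀ {v : Subset (suc q)} → ∃ (λ u → u ∈ subsetsOfSize q k × v ≡ true ∷ u) →
                 ¬ ∃ (λ u → u ∈ subsetsOfSize q (suc k) × v ≡ false ∷ u)
  heads-differ (_ , _ , refl) (_ , _ , ())

subsetsOfSize-size : ∀ q k → All (λ e → ∣ e ∣ₛ ≡ k) (subsetsOfSize q k)
subsetsOfSize-size zero    zero    = refl All.∷ All.[]
subsetsOfSize-size zero    (suc k) = All.[]
subsetsOfSize-size (suc q) zero    = AllP.map⁺ (subsetsOfSize-size q zero)
subsetsOfSize-size (suc q) (suc k) =
  AllP.++⁺ (AllP.map⁺ (All.map (cong suc) (subsetsOfSize-size q k))) (AllP.map⁺ (subsetsOfSize-size q (suc k)))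

complete : ∀ q k → Hypergraph k q
complete q k = record
  { edges   = subsetsOfSize q k
  ; unique  = subsetsOfSize-unique q k
  ; uniform = subsetsOfSize-size q k
  }

∣++∣ : ∀ {p q} (u : Subset p) (v : Subset q) → ∣ u ++ v ∣ₛ ≡ ∣ u ∣ₛ + ∣ v ∣ₛ
∣++∣ []          v = refl
∣++∣ (true ∷ u)  v = cong suc (∣++∣ u v)
∣++∣ (false ∷ u) v = ∣++∣ u v

-- For r = 0 both summands would contain the empty edge.
_⊕_ : ∀ {r p q} .{{_ : NonZero r}} → Hypergraph r p → Hypergraph r q → Hypergraph r (p + q)
_⊕_ {r} {p} {q} H₁ H₂ = record
  { edges   = map (_++ ⊥ {q}) (edges H₁) ++ₗ map (⊥ {p} ++_) (edges H₂)
  ; unique  = Unique.++⁺ (Unique.map⁺ (λ {x} {y} → ++-injectiveˡ x y) (unique H₁))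
                         (Unique.map⁺ (++-injectiveʳ (⊥ {p}) ⊥) (unique H₂)) no-common-edge
  ; uniform = AllP.++⁺ (AllP.map⁺ (All.map (λ {e} → left-size {e}) (uniform H₁)))
                       (AllP.map⁺ (All.map (λ {e} → right-size {e}) (uniform H₂)))
  }
  where
  left-size : ∀ {e} → ∣ e ∣ₛ ≡ r → ∣ e ++ ⊥ {q} ∣ₛ ≡ r
  left-size {e} ∣e∣≡r = trans (∣++∣ e (⊥ {q})) (trans (cong₂ _+_ ∣e∣≡r (∣⊥∣≡0 q)) (+-identityʳ r))
  right-size : ∀ {e} → ∣ e ∣ₛ ≡ r → ∣ ⊥ {p} ++ e ∣ₛ ≡ r
  right-size {e} ∣e∣≡r = trans (∣++∣ (⊥ {p}) e) (cong₂ _+_ (∣⊥∣≡0 p) ∣e∣≡r)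
  no-common-edge : ∀ {v} → ¬ (v ∈ map (_++ ⊥ {q}) (edges H₁) × v ∈ map (⊥ {p} ++_) (edges H₂))
  no-common-edge (∈₁ , ∈₂) with e₁ , e₁∈ , refl ← ∈-map⁻ (_++ ⊥ {q}) ∈₁ | e₂ , _ , e₁⊥≡⊥e₂ ← ∈-map⁻ (⊥ {p} ++_) ∈₂ =
    ≢-nonZero⁻¹ r (trans (sym (All.lookup (uniform H₁) e₁∈)) (trans (cong ∣_∣ₛ (++-injectiveˡ e₁ (⊥ {p}) e₁⊥≡⊥e₂)) (∣⊥∣≡0 p)))

numEdges-⊕ : ∀ {r p q} .{{_ : NonZero r}} (H₁ : Hypergraph r p) (H₂ : Hypergraph r q) →
             numEdges (H₁ ⊕ H₂) ≡ numEdges H₁ + numEdges H₂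
numEdges-⊕ {q = q} H₁ H₂ = trans (length-++ (map (_++ ⊥ {q}) (edges H₁)))
                                 (cong₂ _+_ (length-map _ (edges H₁)) (length-map _ (edges H₂)))

↑-view : ∀ q {n} (x : Fin (q + n)) → (∃ λ i → i ↑ˡ n ≡ x) ⊎ (∃ λ j → q ↑ʳ j ≡ x)
↑-view q x with splitAt q x in eq
... | inj₁ i = inj₁ (i , splitAt⁻¹-↑ˡ eq)
... | inj₂ j = inj₂ (j , splitAt⁻¹-↑ʳ eq)

∈-++⊥ : ∀ {q n} (e : Subset q) {x} → x ∈ₛ e ++ ⊥ {n} → ∃ λ i → i ↑ˡ n ≡ x
∈-++⊥ {q} e {x} x∈ with ↑-view q x
... | inj₁ i↑ˡ = i↑ˡ
... | inj₂ (j , refl) = contradiction (trans (sym ([]=⇒lookup x∈)) (trans (lookup-++ʳ e ⊥ j) (lookup-replicate j false))) λ ()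

∈-⊥++ : ∀ {q n} (e : Subset n) {x} → x ∈ₛ ⊥ {q} ++ e → ∃ λ j → q ↑ʳ j ≡ x × j ∈ₛ e
∈-⊥++ {q} e {x} x∈ with ↑-view q x
... | inj₁ (i , refl) = contradiction (trans (sym ([]=⇒lookup x∈)) (trans (lookup-++ˡ ⊥ e i) (lookup-replicate i false))) λ ()
... | inj₂ (j , refl) = j , refl , lookup⇒[]= j e (trans (sym (lookup-++ʳ (⊥ {q}) e j)) ([]=⇒lookup x∈))

record Clustered (r m n : ℕ) : Set where
  field
    hypergraph     : Hypergraph r n
    cluster        : Fin n → ℕ
    edge-clustered : ∀ {e} → e ∈ edges hypergraph → ∀ {x y} → x ∈ₛ e → y ∈ₛ e → cluster x ≡ cluster y
    cluster-size   : ∀ c → count (λ x → does (cluster x ≟ℕ c)) ≤ m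

open Clustered

completeClustered : ∀ {r m q} → q ≤ m → Clustered r m q
completeClustered {r} {m} {q} q≤m = record
  { hypergraph     = complete q r
  ; cluster        = const 0
  ; edge-clustered = λ _ _ _ → refl
  ; cluster-size   = λ c → ≤-trans (count≤n _) q≤m
  }

adjoinComplete : ∀ {r m n} .{{_ : NonZero r}} q → q ≤ m → Clustered r m n → Clustered r m (q + n)
adjoinComplete {r} {m} {n} q q≤m L = record
  { hypergraph     = complete q r ⊕ hypergraph L
  ; cluster        = cluster′
  ; edge-clustered = edge-clustered′
  ; cluster-size   = cluster-size′
  }
  where
  cluster′ : Fin (q + n) → ℕ
  cluster′ x = [ const 0 , suc ∘ cluster L ]′ (splitAt q x)
  cluster′-↑ˡ : ∀ i → cluster′ (i ↑ˡ n) ≡ 0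
  cluster′-↑ˡ i = cong [ const 0 , suc ∘ cluster L ]′ (splitAt-↑ˡ q i n)
  cluster′-↑ʳ : ∀ j → cluster′ (q ↑ʳ j) ≡ suc (cluster L j)
  cluster′-↑ʳ j = cong [ const 0 , suc ∘ cluster L ]′ (splitAt-↑ʳ q n j)
  edge-clustered′ : ∀ {e} → e ∈ edges (complete q r ⊕ hypergraph L) → ∀ {x y} → x ∈ₛ e → y ∈ₛ e → cluster′ x ≡ cluster′ y
  edge-clustered′ e∈ x∈ y∈ with ∈-++⁻ (map (_++ ⊥ {n}) (subsetsOfSize q r)) e∈
  ... | inj₁ e∈ₗ with e′ , _ , refl ← ∈-map⁻ (_++ ⊥ {n}) e∈ₗ
                 with i , refl ← ∈-++⊥ e′ x∈ | i′ , refl ← ∈-++⊥ e′ y∈ =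
    trans (cluster′-↑ˡ i) (sym (cluster′-↑ˡ i′))
  ... | inj₂ e∈ᵣ with e′ , e′∈ , refl ← ∈-map⁻ (⊥ {q} ++_) e∈ᵣ
                 with j , refl , j∈ ← ∈-⊥++ e′ x∈ | j′ , refl , j′∈ ← ∈-⊥++ e′ y∈ =
    trans (cluster′-↑ʳ j) (trans (cong suc (edge-clustered L e′∈ j∈ j′∈)) (sym (cluster′-↑ʳ j′)))
  cluster-size′ : ∀ c → count (λ x → does (cluster′ x ≟ℕ c)) ≤ m
  cluster-size′ c = begin
    count (λ x → does (cluster′ x ≟ℕ c))
      ≡⟨ sum-↑ q _ ⟩
    count (λ i → does (cluster′ (i ↑ˡ n) ≟ℕ c)) + count (λ j → does (cluster′ (q ↑ʳ j) ≟ℕ c))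
      ≡⟨ cong₂ _+_ (sum-cong-≗ λ i → cong (λ d → if does (d ≟ℕ c) then 1 else 0) (cluster′-↑ˡ i))
                   (sum-cong-≗ λ j → cong (λ d → if does (d ≟ℕ c) then 1 else 0) (cluster′-↑ʳ j)) ⟩
    count {q} (λ _ → does (0 ≟ℕ c)) + count (λ j → does (suc (cluster L j) ≟ℕ c))
      ≤⟨ split-size c ⟩
    m ∎
    where
    open ≤-Reasoning
    split-size : ∀ c → count {q} (λ _ → does (0 ≟ℕ c)) + count (λ j → does (suc (cluster L j) ≟ℕ c)) ≤ m
    split-size zero    = subst (_≤ m) (sym (trans (cong₂ _+_ (count-const q true) (count-const n false)) (+-identityʳ q))) q≤m
    split-size (suc c) = subst (_≤ m) (sym (cong (_+ _) (count-const q false))) (cluster-size L c)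

numEdges-subst : ∀ {r m n n′} (n≡n′ : n ≡ n′) (L : Clustered r m n) →
                 numEdges (hypergraph (subst (Clustered r m) n≡n′ L)) ≡ numEdges (hypergraph L)
numEdges-subst refl L = refl

disjointCompletes : ∀ {r m b} .{{_ : NonZero r}} → b ≤ m → ∀ a →
                    Σ (Clustered r m (a * m + b)) λ L → numEdges (hypergraph L) ≡ a * (m C r) + b C r
disjointCompletes {r} {m} {b} b≤m zero = completeClustered b≤m , length-subsetsOfSize b r
disjointCompletes {r} {m} {b} b≤m (suc a) with L , ∣L∣ ← disjointCompletes b≤m a =
  subst (Clustered r m) reassociate L′ , (begin
    numEdges (hypergraph (subst (Clustered r m) reassociate L′)) ≡⟨ numEdges-subst reassociate L′ ⟩
    numEdges (complete m r ⊕ hypergraph L)                       ≡⟨ numEdges-⊕ (complete m r) (hypergraph L) ⟩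
    numEdges (complete m r) + numEdges (hypergraph L)            ≡⟨ cong₂ _+_ (length-subsetsOfSize m r) ∣L∣ ⟩
    m C r + (a * (m C r) + b C r)                                ≡⟨ +-assoc (m C r) (a * (m C r)) (b C r) ⟨
    suc a * (m C r) + b C r                                      ∎)
  where
  open ≡-Reasoning
  L′ = adjoinComplete m ≤-refl L
  reassociate : m + (a * m + b) ≡ suc a * m + b
  reassociate = sym (+-assoc m (a * m) b)

clustered-star-bound : ∀ {r m n q} (L : Clustered r m n) → InducedBerge (Star (suc q)) (hypergraph L) → r + q ≤ m
clustered-star-bound {r} {m} {n} {q} L (w , f , w-inj , _ , iff) = begin
  r + q                            ≡⟨ cong (_+ q) (count-incidence H (f zero)) ⟨
  count (incidence H (f zero)) + q ≤⟨ count-+-injection leaf leaf-inj leaf∉f₀ (λ j → same-cluster (leaf∈f j)) f₀⊆C ⟩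
  count C                          ≤⟨ cluster-size L (cluster L (w zero)) ⟩
  m                                ∎
  where
  open ≤-Reasoning
  H = hypergraph L
  C : Fin n → Bool
  C y = does (cluster L y ≟ℕ cluster L (w zero))
  centre∈ : ∀ i → w zero ∈ₛ lookupₗ (edges H) (f i)
  centre∈ i = Equivalence.from (iff i zero) (inj₁ refl)
  same-cluster : ∀ {i y} → y ∈ₛ lookupₗ (edges H) (f i) → C y ≡ true
  same-cluster {i} y∈ = dec-true (_ ≟ℕ _) (edge-clustered L (∈-lookup (f i)) y∈ (centre∈ i))
  f₀⊆C : incidence H (f zero) ⊆ᵇ C
  f₀⊆C y f₀y = same-cluster (lookup⇒[]= y _ f₀y)
  leaf : Fin q → Fin n
  leaf j = w (suc (suc j))
  leaf-inj : Injective _≡_ _≡_ leaf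
  leaf-inj = Fin-suc-injective ∘ Fin-suc-injective ∘ w-inj
  leaf∈f : ∀ j → leaf j ∈ₛ lookupₗ (edges H) (f (suc j))
  leaf∈f j = Equivalence.from (iff (suc j) (suc (suc j))) (inj₂ refl)
  leaf∉f₀ : ∀ j → incidence H (f zero) (leaf j) ≡ false
  leaf∉f₀ j with incidence H (f zero) (leaf j) in f₀leaf
  ... | false = refl
  ... | true with Equivalence.to (iff zero (suc (suc j))) (lookup⇒[]= (leaf j) _ f₀leaf)
  ...   | inj₁ ()
  ...   | inj₂ ()

lower-bound : ∀ {k s M} → M ≡ k + suc s → ∀ a {b} → b ≤ M →
              Σ (Hypergraph (suc k) (a * M + b)) λ H →
                ¬ InducedBerge (Star (suc (suc s))) H × a * (M C suc k) + b C suc k ≤ numEdges H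
lower-bound refl a b≤M with L , ∣L∣ ← disjointCompletes b≤M a =
  hypergraph L , (λ star → <-irrefl refl (clustered-star-bound L star)) , ≤-reflexive (sym ∣L∣)

∣-remainder≡0 : ∀ {M a b} → M ∣ a * M + b → b < M → b ≡ 0
∣-remainder≡0 {b = zero}  _   _   = refl
∣-remainder≡0 {a = a} {b = suc _} M∣n b<M = contradiction (∣m+n∣m⇒∣n M∣n (n∣m*n a)) (>⇒∤ b<M)

divisible-identity : ∀ {k N M} a {b} → M ≡ suc N → M ∣ a * M + b → b < M →
                     suc k * (a * (M C suc k) + b C suc k) ≡ (a * M + b) * (N C k)
divisible-identity {k} {N} a refl M∣n b<M with refl ← ∣-remainder≡0 {a = a} M∣n b<M = begin
  suc k * (a * (suc N C suc k) + 0)  ≡⟨ cong (suc k *_) (+-identityʳ _) ⟩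
  suc k * (a * (suc N C suc k))      ≡⟨ x*[y*z]≡y*[x*z] (suc k) a _ ⟩
  a * (suc k * (suc N C suc k))      ≡⟨ cong (a *_) (C-absorb N k) ⟩
  a * (suc N * (N C k))              ≡⟨ *-assoc a (suc N) (N C k) ⟨
  a * suc N * (N C k)                ≡⟨ cong (_* (N C k)) (+-identityʳ (a * suc N)) ⟨
  (a * suc N + 0) * (N C k)          ∎
  where
  open ≡-Reasoning
  x*[y*z]≡y*[x*z] : ∀ x y z → x * (y * z) ≡ y * (x * z)
  x*[y*z]≡y*[x*z] = solve-∀

theorem2p4 : (r t n a b : ℕ) → 2 ≤ r → 3 ≤ t →
    n ≡ a * (r + t ∸ 3) + b → b ≤ r + t ∸ 4 →
    (Σ (Hypergraph r n) λ H → ¬ InducedBerge (Star (t ∸ 1)) H ×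
        a * ((r + t ∸ 3) C r) + b C r ≤ numEdges H)
    × ((H : Hypergraph r n) → ¬ InducedBerge (Star (t ∸ 1)) H →
        r * numEdges H ≤ n * ((r + t ∸ 3) C (r ∸ 1)))
    × ((r + t ∸ 3) ∣ n →
        r * (a * ((r + t ∸ 3) C r) + b C r) ≡ n * ((r + t ∸ 4) C (r ∸ 1)))
theorem2p4 (suc (suc r-2)) (suc (suc (suc t-3))) n a b _ _ refl b≤N =
  lower-bound M≡ a (<⇒≤ b<M) ,
  (λ H star-free → subst (λ M → suc (suc r-2) * numEdges H ≤ n * (M C suc r-2)) (sym M≡)
                         (upper-bound H star-free)) ,
  λ M∣n → divisible-identity a M≡1+N M∣n b<M
  where
  M≡ : suc (suc r-2) + suc (suc (suc t-3)) ∸ 3 ≡ suc r-2 + suc t-3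
  M≡ = trans (cong (_∸ 1) (+-suc r-2 (suc (suc t-3)))) (+-suc r-2 (suc t-3))
  N≡ : suc (suc r-2) + suc (suc (suc t-3)) ∸ 4 ≡ suc r-2 + t-3
  N≡ = trans (cong (_∸ 2) (+-suc r-2 (suc (suc t-3)))) (trans (cong (_∸ 1) (+-suc r-2 (suc t-3))) (+-suc r-2 t-3))
  M≡1+N : suc (suc r-2) + suc (suc (suc t-3)) ∸ 3 ≡ suc (suc (suc r-2) + suc (suc (suc t-3)) ∸ 4)
  M≡1+N = trans M≡ (trans (+-suc (suc r-2) t-3) (cong suc (sym N≡)))
  b<M : b < suc (suc r-2) + suc (suc (suc t-3)) ∸ 3
  b<M = subst (b <_) (sym M≡1+N) (s≤s b≤N)
theorem2p4 zero                _                   _ _ _ () _ _ _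
theorem2p4 (suc zero)          _                   _ _ _ (s≤s ()) _ _ _
theorem2p4 (suc (suc _))       zero                _ _ _ _ () _ _
theorem2p4 (suc (suc _))       (suc zero)          _ _ _ _ (s≤s ()) _ _
theorem2p4 (suc (suc _))       (suc (suc zero))    _ _ _ _ (s≤s (s≤s ())) _ _
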